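{- Let $\delta$ be a real number, let $H$ be a graph on $n$ vertices with minimum degree at least $\left(\frac25-\delta\right)n$, and let $\varphi$ be a surjective homomorphism from $H$ to $C_5$. Then $\left(\frac15-3\delta\right)n\le|\varphi^{ -1}(v)|\le\left(\frac15+2\delta\right)n$ for every $v\in V(C_5)$.
   Context: A homomorphism from $H$ to $C_5$ is a map $V(H)\to V(C_5)$ sending adjacent vertices to adjacent vertices.
   Formalization: The parameter δ ranges over the rationals instead of the reals. -}

module Defs where

open import Data.Nat using (ℕ; suc)
open import Data.Bool using (Bool; true)
open import Data.Fin using (Fin; zero; suc)
open import Data.Fin.Properties using (_≟_)
open import Data.List using (List; length; filter; filterᵇ; allFin)
open import Data.Integer using (+_)
open import Data.Rational using (ℚ; _/_)
open import Data.Product using (∃)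
open import Data.Sum using (_⊎_)
open import Data.Empty using (⊥)
open import Relation.Binary.PropositionalEquality using (_≡_)

record Graph (n : ℕ) : Set where
  field
    adj   : Fin n → Fin n → Bool
    sym   : ∀ u v → adj u v ≡ adj v u
    irrefl : ∀ v → adj v v ≡ true → ⊥
open Graph public

degree : {n : ℕ} → Graph n → Fin n → ℕ
degree G v = length (filterᵇ (adj G v) (allFin _))

succ5 : Fin 5 → Fin 5
succ5 zero = suc zero
succ5 (suc zero) = suc (suc zero)
succ5 (suc (suc zero)) = suc (suc (suc zero))
succ5 (suc (suc (suc zero))) = suc (suc (suc (suc zero)))
succ5 (suc (suc (suc (suc zero)))) = zero

C5Adj : Fin 5 → Fin 5 → Set
C5Adj i j = (j ≡ succ5 i) ⊎ (i ≡ succ5 j)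

IsHomToC5 : {n : ℕ} → Graph n → (Fin n → Fin 5) → Set
IsHomToC5 H φ = ∀ u v → adj H u v ≡ true → C5Adj (φ u) (φ v)

Surjective : {n : ℕ} → (Fin n → Fin 5) → Set
Surjective φ = ∀ w → ∃ λ u → φ u ≡ w

preimageSize : {n : ℕ} → (Fin n → Fin 5) → Fin 5 → ℕ
preimageSize φ w = length (filter (λ u → φ u ≟ w) (allFin _))

ℕtoℚ : ℕ → ℚ
ℕtoℚ k = + k / 1

{-# OPTIONS --safe #-}
module Submission where

-- Write x i = |φ⁻¹(i)| and D = (2/5 − δ)n. A homomorphism sends the neighbours of a
-- vertex in the fibre over i into the fibres over i − 1 and i + 1, so by surjectivity
-- x (i − 1) + x (i + 1) ≥ D for every i. The fibres other than w are the neighbourhood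
-- fibres of w + 2 and of w + 3, hence x w ≤ n − 2D = (1/5 + 2δ)n for every w; and then
-- x w ≥ D − x (w + 2) ≥ 3D − n = (1/5 − 3δ)n.

open import Defs
open import Data.Nat using (ℕ)
open import Data.Fin using (Fin)
open import Data.Integer using (+_)
open import Data.Product using (_×_)
open import Data.Rational using (ℚ; _/_; _+_; _-_; _*_; _≤_)

open import Algebra.Properties.Group using (//-rightDividesʳ)
open import Data.Bool using (true; false; if_then_else_)
open import Data.Bool.Properties using (T-≡)
open import Data.Empty using (⊥-elim)
open import Data.Fin using (zero; suc)
open import Data.Fin.Properties using (_≟_)
import Data.Integer as ℤ
import Data.Integer.Properties as ℤ
open import Data.List using (List; []; _∷_; length; filter; allFin)
open import Data.List.Properties using (length-tabulate)
import Data.Nat as ℕ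
import Data.Nat.Coprimality as Coprimality
import Data.Nat.Properties as ℕ
open import Data.Product using (_,_)
open import Data.Rational using (0ℚ; mkℚ; -_; *≤*)
open import Data.Rational.Properties
  using (normalize-coprime; ≤-trans; +-mono-≤; +-monoˡ-≤; +-monoʳ-≤; +-0-group; +-0-commutativeMonoid; module ≤-Reasoning)
open import Data.Rational.Solver using (module +-*-Solver)
open import Data.Sum using (_⊎_; inj₁; inj₂; [_,_])
open import Function using (_∘_; id)
open import Function.Bundles using (Equivalence)
open import Relation.Binary.PropositionalEquality as ≡
  using (_≡_; refl; trans; cong; cong₂; subst; subst₂; module ≡-Reasoning)
open import Relation.Nullary using (Dec; yes; no; does; T?)
open import Relation.Unary using (Pred; Decidable)

open import Algebra.Properties.CommutativeMonoid.Sum ℕ.+-0-commutativeMonoid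
  using (sum-syntax; ∑-distrib-+; sum-cong-≗; sum-replicate-zero)
open import Algebra.Properties.CommutativeSemigroup ℕ.+-commutativeSemigroup
  using (interchange)
import Algebra.Properties.CommutativeMonoid.Sum +-0-commutativeMonoid as ℚ∑

pred5 : Fin 5 → Fin 5
pred5 zero                         = suc (suc (suc (suc zero)))
pred5 (suc zero)                   = zero
pred5 (suc (suc zero))             = suc zero
pred5 (suc (suc (suc zero)))       = suc (suc zero)
pred5 (suc (suc (suc (suc zero)))) = suc (suc (suc zero))

pred5-succ5 : ∀ i → pred5 (succ5 i) ≡ i
pred5-succ5 zero                         = refl
pred5-succ5 (suc zero)                   = refl
pred5-succ5 (suc (suc zero))             = refl
pred5-succ5 (suc (suc (suc zero)))       = refl
pred5-succ5 (suc (suc (suc (suc zero)))) = refl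

succ5-pred5 : ∀ i → succ5 (pred5 i) ≡ i
succ5-pred5 zero                         = refl
succ5-pred5 (suc zero)                   = refl
succ5-pred5 (suc (suc zero))             = refl
succ5-pred5 (suc (suc (suc zero)))       = refl
succ5-pred5 (suc (suc (suc (suc zero)))) = refl

C5Adj⇒pred5⊎succ5 : ∀ {i j} → C5Adj i j → j ≡ pred5 i ⊎ j ≡ succ5 i
C5Adj⇒pred5⊎succ5 (inj₁ j≡succ5-i) = inj₂ j≡succ5-i
C5Adj⇒pred5⊎succ5 {j = j} (inj₂ i≡succ5-j) =
  inj₁ (trans (≡.sym (pred5-succ5 j)) (cong pred5 (≡.sym i≡succ5-j)))

indicator : ∀ {p} {P : Set p} → Dec P → ℕ
indicator P? = if does P? then 1 else 0

∑-indicator-≟ : ∀ {k} (c : Fin k) → ∑[ i < k ] indicator (c ≟ i) ≡ 1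
∑-indicator-≟ {ℕ.suc k} zero = cong ℕ.suc (sum-replicate-zero k)
∑-indicator-≟ (suc c)      = ∑-indicator-≟ c

module _ {a} {A : Set a} where

  length-filter-∷ : ∀ {p} {P : Pred A p} (P? : Decidable P) x xs →
                    length (filter P? (x ∷ xs)) ≡ indicator (P? x) ℕ.+ length (filter P? xs)
  length-filter-∷ P? x xs with does (P? x)
  ... | true  = refl
  ... | false = refl

  module _ {p q r} {P : Pred A p} {Q : Pred A q} {R : Pred A r}
           (P? : Decidable P) (Q? : Decidable Q) (R? : Decidable R)
           (P⊆Q∪R : ∀ {x} → P x → Q x ⊎ R x) where

    indicator-⊆-∪ : ∀ x → indicator (P? x) ℕ.≤ indicator (Q? x) ℕ.+ indicator (R? x)
    indicator-⊆-∪ x with P? x | Q? x | R? x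
    ... | no _   | _      | _      = ℕ.z≤n
    ... | yes _  | yes _  | _      = ℕ.s≤s ℕ.z≤n
    ... | yes _  | no _   | yes _  = ℕ.s≤s ℕ.z≤n
    ... | yes px | no ¬qx | no ¬rx = ⊥-elim ([ ¬qx , ¬rx ] (P⊆Q∪R px))

    length-filter-⊆-∪ : ∀ xs → length (filter P? xs) ℕ.≤ length (filter Q? xs) ℕ.+ length (filter R? xs)
    length-filter-⊆-∪ []       = ℕ.z≤n
    length-filter-⊆-∪ (x ∷ xs) = begin
      length (filter P? (x ∷ xs))                  ≡⟨ length-filter-∷ P? x xs ⟩
      indicator (P? x) ℕ.+ length (filter P? xs)   ≤⟨ ℕ.+-mono-≤ (indicator-⊆-∪ x) (length-filter-⊆-∪ xs) ⟩
      (indicator (Q? x) ℕ.+ indicator (R? x)) ℕ.+ (length (filter Q? xs) ℕ.+ length (filter R? xs))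
        ≡⟨ interchange (indicator (Q? x)) _ _ _ ⟩
      (indicator (Q? x) ℕ.+ length (filter Q? xs)) ℕ.+ (indicator (R? x) ℕ.+ length (filter R? xs))
        ≡⟨ ≡.sym (cong₂ ℕ._+_ (length-filter-∷ Q? x xs) (length-filter-∷ R? x xs)) ⟩
      length (filter Q? (x ∷ xs)) ℕ.+ length (filter R? (x ∷ xs)) ∎
      where open ℕ.≤-Reasoning

  length≡∑-fibres : ∀ {k} (f : A → Fin k) xs → length xs ≡ ∑[ i < k ] length (filter (λ x → f x ≟ i) xs)
  length≡∑-fibres {k} f []       = ≡.sym (sum-replicate-zero k)
  length≡∑-fibres {k} f (x ∷ xs) = begin
    ℕ.suc (length xs)                                ≡⟨ cong ℕ.suc (length≡∑-fibres f xs) ⟩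
    1 ℕ.+ ∑[ i < k ] fibre i xs                      ≡⟨ cong (ℕ._+ ∑[ i < k ] fibre i xs) (≡.sym (∑-indicator-≟ (f x))) ⟩
    ∑[ i < k ] indicator (f x ≟ i) ℕ.+ ∑[ i < k ] fibre i xs
                                                     ≡⟨ ≡.sym (∑-distrib-+ (λ i → indicator (f x ≟ i)) (λ i → fibre i xs)) ⟩
    ∑[ i < k ] (indicator (f x ≟ i) ℕ.+ fibre i xs)  ≡⟨ sum-cong-≗ (λ i → ≡.sym (length-filter-∷ (λ y → f y ≟ i) x xs)) ⟩
    ∑[ i < k ] fibre i (x ∷ xs)                      ∎
    where
    open ≡-Reasoning
    fibre : Fin k → List A → ℕ
    fibre i ys = length (filter (λ y → f y ≟ i) ys)

-- For a variable k, ℕtoℚ k = + k / 1 is stuck on gcd k 1; in this normal form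
-- the sum of two naturals computes.
ℕtoℚ≡mkℚ : ∀ k → ℕtoℚ k ≡ mkℚ (+ k) 0 (Coprimality.sym (Coprimality.1-coprimeTo k))
ℕtoℚ≡mkℚ k = normalize-coprime (Coprimality.sym (Coprimality.1-coprimeTo k))

ℕtoℚ-+ : ∀ a b → ℕtoℚ (a ℕ.+ b) ≡ ℕtoℚ a + ℕtoℚ b
ℕtoℚ-+ a b = begin
  + (a ℕ.+ b) / 1                           ≡⟨ cong₂ (λ p q → (p ℤ.+ q) / 1) (ℤ.*-identityʳ (+ a)) (ℤ.*-identityʳ (+ b)) ⟨
  (+ a ℤ.* + 1 ℤ.+ + b ℤ.* + 1) / 1         ≡⟨ cong₂ _+_ (ℕtoℚ≡mkℚ a) (ℕtoℚ≡mkℚ b) ⟨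
  ℕtoℚ a + ℕtoℚ b                           ∎
  where open ≡-Reasoning

ℕtoℚ-mono-≤ : ∀ {a b} → a ℕ.≤ b → ℕtoℚ a ≤ ℕtoℚ b
ℕtoℚ-mono-≤ {a} {b} a≤b rewrite ℕtoℚ≡mkℚ a | ℕtoℚ≡mkℚ b =
  *≤* (subst₂ ℤ._≤_ (≡.sym (ℤ.*-identityʳ (+ a))) (≡.sym (ℤ.*-identityʳ (+ b))) (ℤ.+≤+ a≤b))

ℕtoℚ-∑ : ∀ {k} (f : Fin k → ℕ) → ℕtoℚ (∑[ i < k ] f i) ≡ ℚ∑.sum (ℕtoℚ ∘ f)
ℕtoℚ-∑ {ℕ.zero} f = refl
ℕtoℚ-∑ {ℕ.suc k} f = trans (ℕtoℚ-+ (f zero) _) (cong (λ q → ℕtoℚ (f zero) + q) (ℕtoℚ-∑ (f ∘ suc)))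

p+q≤r⇒p≤r-q : ∀ {p q r} → p + q ≤ r → p ≤ r - q
p+q≤r⇒p≤r-q {p} {q} {r} p+q≤r = subst (_≤ r - q) (//-rightDividesʳ +-0-group q p) (+-monoˡ-≤ (- q) p+q≤r)

p≤q+r⇒p-r≤q : ∀ {p q r} → p ≤ q + r → p - r ≤ q
p≤q+r⇒p-r≤q {p} {q} {r} p≤q+r = subst (p - r ≤_) (//-rightDividesʳ +-0-group r q) (+-monoˡ-≤ (- r) p≤q+r)

record DenseFibres (N D : ℚ) (x : Fin 5 → ℚ) : Set where
  field
    total      : ℚ∑.sum x ≡ N
    neighbours : ∀ i → D ≤ x (pred5 i) + x (succ5 i)

module _ {N D : ℚ} where

  DenseFibres-rotate : ∀ {x} → DenseFibres N D x → DenseFibres N D (x ∘ succ5)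
  DenseFibres-rotate {x} fibres = record
    { total      = trans (∑-rotate (x zero) (x (suc zero)) (x (suc (suc zero)))
                                   (x (suc (suc (suc zero)))) (x (suc (suc (suc (suc zero))))))
                         total
    ; neighbours = λ i → subst (λ j → D ≤ x j + x (succ5 (succ5 i)))
                               (trans (pred5-succ5 i) (≡.sym (succ5-pred5 i)))
                               (neighbours (succ5 i))
    }
    where
    open DenseFibres fibres
    open +-*-Solver
    ∑-rotate : ∀ x₀ x₁ x₂ x₃ x₄ → x₁ + (x₂ + (x₃ + (x₄ + (x₀ + 0ℚ)))) ≡ x₀ + (x₁ + (x₂ + (x₃ + (x₄ + 0ℚ))))
    ∑-rotate = solve 5 (λ x₀ x₁ x₂ x₃ x₄ → x₁ :+ (x₂ :+ (x₃ :+ (x₄ :+ (x₀ :+ con 0ℚ))))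
                                      := x₀ :+ (x₁ :+ (x₂ :+ (x₃ :+ (x₄ :+ con 0ℚ))))) refl

  fibre-zero-≤ : ∀ {x} → DenseFibres N D x → x zero ≤ N - (D + D)
  fibre-zero-≤ {x} fibres = p+q≤r⇒p≤r-q (begin
    x₀ + (D + D)                   ≤⟨ +-monoʳ-≤ x₀ (+-mono-≤ (neighbours (suc (suc zero))) (neighbours (suc (suc (suc zero))))) ⟩
    x₀ + ((x₁ + x₃) + (x₂ + x₄))   ≡⟨ regroup x₀ x₁ x₂ x₃ x₄ ⟩
    ℚ∑.sum x                       ≡⟨ total ⟩
    N                              ∎)
    where
    open DenseFibres fibres
    open ≤-Reasoning
    open +-*-Solver
    x₀ x₁ x₂ x₃ x₄ : ℚ
    x₀ = x zero
    x₁ = x (suc zero)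
    x₂ = x (suc (suc zero))
    x₃ = x (suc (suc (suc zero)))
    x₄ = x (suc (suc (suc (suc zero))))
    regroup : ∀ x₀ x₁ x₂ x₃ x₄ → x₀ + ((x₁ + x₃) + (x₂ + x₄)) ≡ x₀ + (x₁ + (x₂ + (x₃ + (x₄ + 0ℚ))))
    regroup = solve 5 (λ x₀ x₁ x₂ x₃ x₄ → x₀ :+ ((x₁ :+ x₃) :+ (x₂ :+ x₄))
                                       := x₀ :+ (x₁ :+ (x₂ :+ (x₃ :+ (x₄ :+ con 0ℚ))))) refl

  fibre-≤ : ∀ {x} → DenseFibres N D x → ∀ w → x w ≤ N - (D + D)
  fibre-≤ fibres zero                         = fibre-zero-≤ fibres
  fibre-≤ fibres (suc zero)                   = fibre-zero-≤ (DenseFibres-rotate fibres)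
  fibre-≤ fibres (suc (suc zero))             =
    fibre-zero-≤ (DenseFibres-rotate (DenseFibres-rotate fibres))
  fibre-≤ fibres (suc (suc (suc zero)))       =
    fibre-zero-≤ (DenseFibres-rotate (DenseFibres-rotate (DenseFibres-rotate fibres)))
  fibre-≤ fibres (suc (suc (suc (suc zero)))) =
    fibre-zero-≤ (DenseFibres-rotate (DenseFibres-rotate (DenseFibres-rotate (DenseFibres-rotate fibres))))

  fibre-≥ : ∀ {x} → DenseFibres N D x → ∀ w → D - (N - (D + D)) ≤ x w
  fibre-≥ {x} fibres w = p≤q+r⇒p-r≤q (begin
    D                                         ≤⟨ DenseFibres.neighbours fibres (succ5 w) ⟩
    x (pred5 (succ5 w)) + x (succ5 (succ5 w)) ≡⟨ cong (λ j → x j + x (succ5 (succ5 w))) (pred5-succ5 w) ⟩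
    x w + x (succ5 (succ5 w))                 ≤⟨ +-monoʳ-≤ (x w) (fibre-≤ fibres (succ5 (succ5 w))) ⟩
    x w + (N - (D + D))                       ∎)
    where open ≤-Reasoning

degree≤neighbour-fibres : ∀ {n} (H : Graph n) {φ : Fin n → Fin 5} → IsHomToC5 H φ → ∀ v →
                          degree H v ℕ.≤ preimageSize φ (pred5 (φ v)) ℕ.+ preimageSize φ (succ5 (φ v))
degree≤neighbour-fibres {n} H {φ} hom v =
  length-filter-⊆-∪ (T? ∘ adj H v) (λ u → φ u ≟ pred5 (φ v)) (λ u → φ u ≟ succ5 (φ v))
                    (λ {u} v~u → C5Adj⇒pred5⊎succ5 (hom v u (Equivalence.to T-≡ v~u)))
                    (allFin n)

n≡∑-preimageSize : ∀ {n} (φ : Fin n → Fin 5) → n ≡ ∑[ i < 5 ] preimageSize φ i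
n≡∑-preimageSize {n} φ = trans (≡.sym (length-tabulate id)) (length≡∑-fibres φ (allFin n))

fibres-dense : ∀ {n D} (H : Graph n) {φ : Fin n → Fin 5} →
               (∀ v → D ≤ ℕtoℚ (degree H v)) → IsHomToC5 H φ → Surjective φ →
               DenseFibres (ℕtoℚ n) D (ℕtoℚ ∘ preimageSize φ)
fibres-dense {n} {D} H {φ} minDegree hom surj = record
  { total      = ≡.sym (trans (cong ℕtoℚ (n≡∑-preimageSize φ)) (ℕtoℚ-∑ (preimageSize φ)))
  ; neighbours = neighbours
  }
  where
  neighbours : ∀ i → D ≤ ℕtoℚ (preimageSize φ (pred5 i)) + ℕtoℚ (preimageSize φ (succ5 i))
  neighbours i with surj i
  ... | v , refl = ≤-trans (minDegree v)
    (subst (ℕtoℚ (degree H v) ≤_)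
           (ℕtoℚ-+ (preimageSize φ (pred5 (φ v))) (preimageSize φ (succ5 (φ v))))
           (ℕtoℚ-mono-≤ (degree≤neighbour-fibres H hom v)))

module _ (δ N : ℚ) where
  open +-*-Solver

  private
    D : ℚ
    D = ((+ 2 / 5) - δ) * N

  N-2D≡[1/5+2δ]N : N - (D + D) ≡ ((+ 1 / 5) + (+ 2 / 1) * δ) * N
  N-2D≡[1/5+2δ]N = solve 2 (λ δ N → N :- ((con (+ 2 / 5) :- δ) :* N :+ (con (+ 2 / 5) :- δ) :* N)
                                 := (con (+ 1 / 5) :+ con (+ 2 / 1) :* δ) :* N) refl δ N

  3D-N≡[1/5-3δ]N : D - (N - (D + D)) ≡ ((+ 1 / 5) - (+ 3 / 1) * δ) * N
  3D-N≡[1/5-3δ]N = solve 2 (λ δ N → (con (+ 2 / 5) :- δ) :* N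
                                      :- (N :- ((con (+ 2 / 5) :- δ) :* N :+ (con (+ 2 / 5) :- δ) :* N))
                                 := (con (+ 1 / 5) :- con (+ 3 / 1) :* δ) :* N) refl δ N

lemma5p4 : (δ : ℚ) (n : ℕ) (H : Graph n) (φ : Fin n → Fin 5) →
    (∀ v → ((+ 2 / 5) - δ) * ℕtoℚ n ≤ ℕtoℚ (degree H v)) →
    IsHomToC5 H φ → Surjective φ →
    ∀ w → (((+ 1 / 5) - (+ 3 / 1) * δ) * ℕtoℚ n ≤ ℕtoℚ (preimageSize φ w))
        × (ℕtoℚ (preimageSize φ w) ≤ ((+ 1 / 5) + (+ 2 / 1) * δ) * ℕtoℚ n)
lemma5p4 δ n H φ minDegree hom surj w =
    subst (_≤ ℕtoℚ (preimageSize φ w)) (3D-N≡[1/5-3δ]N δ (ℕtoℚ n)) (fibre-≥ fibres w)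
  , subst (ℕtoℚ (preimageSize φ w) ≤_) (N-2D≡[1/5+2δ]N δ (ℕtoℚ n)) (fibre-≤ fibres w)
  where
  fibres : DenseFibres (ℕtoℚ n) (((+ 2 / 5) - δ) * ℕtoℚ n) (ℕtoℚ ∘ preimageSize φ)
  fibres = fibres-dense H minDegree hom surj
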